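{- If $S\in\mathbb{R}^3_{>0}$ satisfies (M1), then $C(S)\le 4$.
   Context: $\gamma_1(p,q,r)=(qr-p,q,r)$, $\gamma_2(p,q,r)=(p,rp-q,r)$, $\gamma_3(p,q,r)=(p,q,pq-r)$. Order on $\mathbb{R}^3$ is entrywise; $S$ satisfies (M1) if $S\le\gamma_i(S)$ for all $i\in\{1,2,3\}$. $C(p,q,r)=p^2+q^2+r^2-pqr$. -}

module Defs where

open import Level using (Level; _⊔_) renaming (suc to lsuc)
open import Algebra.Bundles using (CommutativeRing)
open import Relation.Binary.Core using (Rel)
open import Relation.Binary.Structures using (IsTotalOrder)
open import Relation.Nullary using (¬_)
open import Data.Product using (_×_; _,_; ∃)
open import Data.Fin using (Fin; zero; suc)

-- The real numbers, axiomatised as a (Dedekind-)complete ordered field.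
-- Any two models are isomorphic, so quantifying over all models is
-- the same as speaking about ℝ.
record CompleteOrderedField c ℓ₁ ℓ₂ : Set (lsuc (c ⊔ ℓ₁ ⊔ ℓ₂)) where
  field
    commutativeRing : CommutativeRing c ℓ₁
  open CommutativeRing commutativeRing public
  field
    _≤_          : Rel Carrier ℓ₂
    isTotalOrder : IsTotalOrder _≈_ _≤_
    0≉1          : ¬ (0# ≈ 1#)
    inverse      : ∀ x → ¬ (x ≈ 0#) → ∃ λ y → x * y ≈ 1#
    +-mono-≤     : ∀ {x y} z → x ≤ y → (x + z) ≤ (y + z)
    *-nonneg     : ∀ {x y} → 0# ≤ x → 0# ≤ y → 0# ≤ (x * y)
    lub          : ∀ (P : Carrier → Set c) → ∃ P →
                   ∃ (λ b → ∀ x → P x → x ≤ b) →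
                   ∃ λ s → (∀ x → P x → x ≤ s) ×
                           (∀ b → (∀ x → P x → x ≤ b) → s ≤ b)

  _<_ : Rel Carrier (ℓ₁ ⊔ ℓ₂)
  x < y = (x ≤ y) × ¬ (x ≈ y)

module Markov {c ℓ₁ ℓ₂} (ℝ : CompleteOrderedField c ℓ₁ ℓ₂) where
  open CompleteOrderedField ℝ

  ℝ³ : Set c
  ℝ³ = Carrier × Carrier × Carrier

  _≤³_ : ℝ³ → ℝ³ → Set ℓ₂
  (p , q , r) ≤³ (p′ , q′ , r′) = (p ≤ p′) × (q ≤ q′) × (r ≤ r′)

  Positive : ℝ³ → Set (ℓ₁ ⊔ ℓ₂)
  Positive (p , q , r) = (0# < p) × (0# < q) × (0# < r)

  γ₁ γ₂ γ₃ : ℝ³ → ℝ³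
  γ₁ (p , q , r) = (q * r - p , q , r)
  γ₂ (p , q , r) = (p , r * p - q , r)
  γ₃ (p , q , r) = (p , q , p * q - r)

  γ : Fin 3 → ℝ³ → ℝ³
  γ zero = γ₁
  γ (suc zero) = γ₂
  γ (suc (suc zero)) = γ₃

  M1 : ℝ³ → Set ℓ₂
  M1 S = ∀ (i : Fin 3) → S ≤³ γ i S

  C : ℝ³ → Carrier
  C (p , q , r) = p * p + q * q + r * r - p * q * r

  4# : Carrier
  4# = 1# + 1# + 1# + 1#

-- (M1) reads 2p ≤ qr, 2q ≤ rp, 2r ≤ pq, and both it and C are symmetric, so we may
-- take x ≤ y ≤ z. The two largest inequalities force x ≥ 2, and then 4 − C(x, y, z)
-- splits as a sum of two products of nonnegative factors.
module Submission where

open import Defs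
open import Data.Product using (_×_; _,_; proj₁; proj₂)
open import Data.Sum using (_⊎_; inj₁; inj₂)
open import Data.Fin using (zero; suc)
open import Relation.Nullary using (¬_)
open import Relation.Binary.Bundles using (Poset)
open import Relation.Binary.Structures using (IsTotalOrder)
import Relation.Binary.Reasoning.PartialOrder as PartialOrderReasoning

module OrderedFieldProperties {c ℓ₁ ℓ₂} (F : CompleteOrderedField c ℓ₁ ℓ₂) where
  open CompleteOrderedField F
    renaming (+-mono-≤ to +-monoˡ-≤; _≤_ to infix 4 _≤_; _<_ to infix 4 _<_)
  open IsTotalOrder isTotalOrder public
    using (total; antisym; ≤-respˡ-≈; ≤-respʳ-≈)
    renaming (trans to ≤-trans; refl to ≤-refl; reflexive to ≤-reflexive)
  open IsTotalOrder isTotalOrder using (isPartialOrder)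
  open import Algebra.Properties.Ring ring using (-1*x≈-x; -‿involutive)
  open import Algebra.Solver.Ring.NaturalCoefficients.Default commutativeSemiring public

  poset : Poset c ℓ₁ ℓ₂
  poset = record { isPartialOrder = isPartialOrder }

  module ≤-Reasoning = PartialOrderReasoning poset

  2# : Carrier
  2# = 1# + 1#

  +-monoʳ-≤ : ∀ {a b} c → a ≤ b → c + a ≤ c + b
  +-monoʳ-≤ {a} {b} c a≤b = ≤-respˡ-≈ (+-comm a c) (≤-respʳ-≈ (+-comm b c) (+-monoˡ-≤ c a≤b))

  +-mono-≤ : ∀ {a b c d} → a ≤ b → c ≤ d → a + c ≤ b + d
  +-mono-≤ {b = b} {c} a≤b c≤d = ≤-trans (+-monoˡ-≤ c a≤b) (+-monoʳ-≤ b c≤d)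

  x+y-y≈x : ∀ x y → x + y - y ≈ x
  x+y-y≈x x y = trans (+-assoc x y (- y)) (trans (+-congˡ (-‿inverseʳ y)) (+-identityʳ x))

  x-y+y≈x : ∀ x y → x - y + y ≈ x
  x-y+y≈x x y = trans (+-assoc x (- y) y) (trans (+-congˡ (-‿inverseˡ y)) (+-identityʳ x))

  x+[y-x]≈y : ∀ x y → x + (y - x) ≈ y
  x+[y-x]≈y x y = trans (+-comm x (y - x)) (x-y+y≈x y x)

  +-cancelʳ-≤ : ∀ {a b} c → a + c ≤ b + c → a ≤ b
  +-cancelʳ-≤ {a} {b} c a+c≤b+c =
    ≤-respˡ-≈ (x+y-y≈x a c) (≤-respʳ-≈ (x+y-y≈x b c) (+-monoˡ-≤ (- c) a+c≤b+c))

  x≤y-x⇒x+x≤y : ∀ {x y} → x ≤ y - x → x + x ≤ y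
  x≤y-x⇒x+x≤y {x} {y} x≤y-x = ≤-respʳ-≈ (x-y+y≈x y x) (+-monoˡ-≤ x x≤y-x)

  x≤y+z⇒x-z≤y : ∀ {x y z} → x ≤ y + z → x - z ≤ y
  x≤y+z⇒x-z≤y {x} {y} {z} x≤y+z = +-cancelʳ-≤ z (≤-respˡ-≈ (sym (x-y+y≈x x z)) x≤y+z)

  x≤y⇒0≤y-x : ∀ {x y} → x ≤ y → 0# ≤ y - x
  x≤y⇒0≤y-x {x} x≤y = ≤-respˡ-≈ (-‿inverseʳ x) (+-monoˡ-≤ (- x) x≤y)

  0≤1 : 0# ≤ 1#
  0≤1 with total 0# 1#
  ... | inj₁ 0≤1 = 0≤1
  ... | inj₂ 1≤0 = ≤-respʳ-≈ [-1][-1]≈1 (*-nonneg 0≤-1 0≤-1)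
    where
    0≤-1 : 0# ≤ - 1#
    0≤-1 = ≤-respʳ-≈ (+-identityˡ (- 1#)) (x≤y⇒0≤y-x 1≤0)
    [-1][-1]≈1 : - 1# * - 1# ≈ 1#
    [-1][-1]≈1 = trans (-1*x≈-x (- 1#)) (-‿involutive 1#)

  0<1 : 0# < 1#
  0<1 = 0≤1 , 0≉1

  nonNeg+nonNeg⇒nonNeg : ∀ {a b} → 0# ≤ a → 0# ≤ b → 0# ≤ a + b
  nonNeg+nonNeg⇒nonNeg 0≤a 0≤b = ≤-respˡ-≈ (+-identityʳ 0#) (+-mono-≤ 0≤a 0≤b)

  pos+nonNeg⇒pos : ∀ {a b} → 0# < a → 0# ≤ b → 0# < a + b
  pos+nonNeg⇒pos {a} {b} (0≤a , 0≉a) 0≤b = nonNeg+nonNeg⇒nonNeg 0≤a 0≤b , 0≉a+b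
    where
    0≉a+b : ¬ (0# ≈ a + b)
    0≉a+b 0≈a+b = 0≉a (antisym 0≤a a≤0)
      where
      a≤0 : a ≤ 0#
      a≤0 = ≤-respˡ-≈ (+-identityʳ a) (≤-respʳ-≈ (sym 0≈a+b) (+-monoʳ-≤ a 0≤b))

  0<2 : 0# < 2#
  0<2 = pos+nonNeg⇒pos 0<1 0≤1

  *-monoʳ-≤-nonNeg : ∀ {a b c} → 0# ≤ c → a ≤ b → c * a ≤ c * b
  *-monoʳ-≤-nonNeg {a} {b} {c} 0≤c a≤b = begin
    c * a                ≈⟨ +-identityʳ (c * a) ⟨
    c * a + 0#           ≤⟨ +-monoʳ-≤ (c * a) (*-nonneg 0≤c (x≤y⇒0≤y-x a≤b)) ⟩
    c * a + c * (b - a)  ≈⟨ distribˡ c a (b - a) ⟨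
    c * (a + (b - a))    ≈⟨ *-congˡ (x+[y-x]≈y a b) ⟩
    c * b                ∎
    where open ≤-Reasoning

  *-mono-≤-nonNeg : ∀ {a b c d} → 0# ≤ a → 0# ≤ d → a ≤ b → c ≤ d → a * c ≤ b * d
  *-mono-≤-nonNeg {a} {b} {c} {d} 0≤a 0≤d a≤b c≤d = begin
    a * c  ≤⟨ *-monoʳ-≤-nonNeg 0≤a c≤d ⟩
    a * d  ≈⟨ *-comm a d ⟩
    d * a  ≤⟨ *-monoʳ-≤-nonNeg 0≤d a≤b ⟩
    d * b  ≈⟨ *-comm d b ⟩
    b * d  ∎
    where open ≤-Reasoning

  -- (b − a)(d − c) ≥ 0, written without subtraction.
  rearrangement : ∀ {a b c d} → a ≤ b → c ≤ d → a * d + b * c ≤ a * c + b * d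
  rearrangement {a} {b} {c} {d} a≤b c≤d = begin
    a * d + b * c          ≈⟨ +-congˡ (*-congʳ (x+[y-x]≈y a b)) ⟨
    a * d + (a + e) * c    ≈⟨ solve 4 (λ a e c d → a :* d :+ (a :+ e) :* c
                                                 := a :* d :+ a :* c :+ e :* c) refl a e c d ⟩
    a * d + a * c + e * c  ≤⟨ +-monoʳ-≤ (a * d + a * c) (*-monoʳ-≤-nonNeg (x≤y⇒0≤y-x a≤b) c≤d) ⟩
    a * d + a * c + e * d  ≈⟨ solve 4 (λ a e c d → a :* d :+ a :* c :+ e :* d
                                                 := a :* c :+ (a :+ e) :* d) refl a e c d ⟩
    a * c + (a + e) * d    ≈⟨ +-congˡ (*-congʳ (x+[y-x]≈y a b)) ⟩
    a * c + b * d          ∎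
    where
    open ≤-Reasoning
    e = b - a

  *-cancelˡ-≤-pos : ∀ {a b c} → 0# < c → c * a ≤ c * b → a ≤ b
  *-cancelˡ-≤-pos {a} {b} {c} (0≤c , 0≉c) ca≤cb with total a b
  ... | inj₁ a≤b = a≤b
  ... | inj₂ b≤a = ≤-reflexive (begin-equality
    a              ≈⟨ c⁻¹[ct]≈t a ⟨
    c⁻¹ * (c * a)  ≈⟨ *-congˡ (antisym ca≤cb (*-monoʳ-≤-nonNeg 0≤c b≤a)) ⟩
    c⁻¹ * (c * b)  ≈⟨ c⁻¹[ct]≈t b ⟩
    b              ∎)
    where
    open ≤-Reasoning
    c⁻¹ : Carrier
    c⁻¹ = proj₁ (inverse c (λ c≈0 → 0≉c (sym c≈0)))
    c⁻¹[ct]≈t : ∀ t → c⁻¹ * (c * t) ≈ t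
    c⁻¹[ct]≈t t = trans (solve 3 (λ c⁻¹ c t → c⁻¹ :* (c :* t) := (c :* c⁻¹) :* t) refl c⁻¹ c t)
                    (trans (*-congʳ (proj₂ (inverse c _))) (*-identityˡ t))

  x*x≤y*y⇒x≤y : ∀ {x y} → 0# < x → 0# ≤ y → x * x ≤ y * y → x ≤ y
  x*x≤y*y⇒x≤y {x} {y} 0<x 0≤y x²≤y² = *-cancelˡ-≤-pos (pos+nonNeg⇒pos 0<x 0≤y) (begin
    (x + y) * x        ≈⟨ solve 2 (λ x y → (x :+ y) :* x := x :* x :+ x :* y) refl x y ⟩
    x * x + x * y      ≤⟨ +-monoˡ-≤ (x * y) x²≤y² ⟩
    y * y + x * y      ≈⟨ solve 2 (λ x y → y :* y :+ x :* y := (x :+ y) :* y) refl x y ⟩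
    (x + y) * y        ∎)
    where open ≤-Reasoning

module MarkovProperties {c ℓ₁ ℓ₂} (F : CompleteOrderedField c ℓ₁ ℓ₂) where
  open CompleteOrderedField F hiding (zero)
    renaming (+-mono-≤ to +-monoˡ-≤; _≤_ to infix 4 _≤_; _<_ to infix 4 _<_)
  open OrderedFieldProperties F
  open Markov F

  DoubleBelowProduct : Carrier → Carrier → Carrier → Set ℓ₂
  DoubleBelowProduct x y z = x + x ≤ y * z × y + y ≤ z * x × z + z ≤ x * y

  M1⇒DoubleBelowProduct : ∀ {x y z} → M1 (x , y , z) → DoubleBelowProduct x y z
  M1⇒DoubleBelowProduct m =
    x≤y-x⇒x+x≤y (proj₁ (m zero)) ,
    x≤y-x⇒x+x≤y (proj₁ (proj₂ (m (suc zero)))) ,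
    x≤y-x⇒x+x≤y (proj₂ (proj₂ (m (suc (suc zero)))))

  DoubleBelowProduct-rotate : ∀ {x y z} → DoubleBelowProduct x y z → DoubleBelowProduct y z x
  DoubleBelowProduct-rotate (x+x≤yz , y+y≤zx , z+z≤xy) = y+y≤zx , z+z≤xy , x+x≤yz

  DoubleBelowProduct-swap : ∀ {x y z} → DoubleBelowProduct x y z → DoubleBelowProduct x z y
  DoubleBelowProduct-swap {x} {y} {z} (x+x≤yz , y+y≤zx , z+z≤xy) =
    ≤-respʳ-≈ (*-comm y z) x+x≤yz , ≤-respʳ-≈ (*-comm x y) z+z≤xy , ≤-respʳ-≈ (*-comm z x) y+y≤zx

  C-rotate : ∀ x y z → C (x , y , z) ≈ C (y , z , x)
  C-rotate x y z = +-cong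
    (solve 3 (λ x y z → x :* x :+ y :* y :+ z :* z := y :* y :+ z :* z :+ x :* x) refl x y z)
    (-‿cong (solve 3 (λ x y z → x :* y :* z := y :* z :* x) refl x y z))

  C-swap : ∀ x y z → C (x , y , z) ≈ C (x , z , y)
  C-swap x y z = +-cong
    (solve 3 (λ x y z → x :* x :+ y :* y :+ z :* z := x :* x :+ z :* z :+ y :* y) refl x y z)
    (-‿cong (solve 3 (λ x y z → x :* y :* z := x :* z :* y) refl x y z))

  -- x (2z ≤ xy) + 2 (2y ≤ zx) gives 4y ≤ x²y.
  2≤x : ∀ {x y z} → 0# ≤ x → 0# < y → y + y ≤ z * x → z + z ≤ x * y → 2# ≤ x
  2≤x {x} {y} {z} 0≤x 0<y y+y≤zx z+z≤xy =
    x*x≤y*y⇒x≤y 0<2 0≤x (≤-respˡ-≈ (solve 0 (con 4 := con 2 :* con 2) refl) 4≤x*x)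
    where
    open ≤-Reasoning
    4≤x*x : 4# ≤ x * x
    4≤x*x = *-cancelˡ-≤-pos 0<y (+-cancelʳ-≤ (x * (z + z)) (begin
      y * 4# + x * (z + z)             ≈⟨ solve 3 (λ x y z → y :* con 4 :+ x :* (z :+ z)
                                                  := (y :+ y) :+ (y :+ y) :+ x :* (z :+ z)) refl x y z ⟩
      (y + y) + (y + y) + x * (z + z)  ≤⟨ +-mono-≤ (+-mono-≤ y+y≤zx y+y≤zx) (*-monoʳ-≤-nonNeg 0≤x z+z≤xy) ⟩
      z * x + z * x + x * (x * y)      ≈⟨ solve 3 (λ x y z → z :* x :+ z :* x :+ x :* (x :* y)
                                                  := y :* (x :* x) :+ x :* (z :+ z)) refl x y z ⟩
      y * (x * x) + x * (z + z)        ∎))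

  -- 4 − C(x, y, z) = (z − y)(xy − (z + y)) + (x − 2)(y² − (x + 2)), and u′ − u, v′ − v are
  -- these two products.
  C≤4-if-2≤x≤y≤z : ∀ {x y z} → 2# ≤ x → x ≤ y → y ≤ z → z + y ≤ x * y → C (x , y , z) ≤ 4#
  C≤4-if-2≤x≤y≤z {x} {y} {z} 2≤x x≤y y≤z z+y≤xy = x≤y+z⇒x-z≤y (+-cancelʳ-≤ (u + v) (begin
    x * x + y * y + z * z + (u + v)   ≤⟨ +-monoʳ-≤ (x * x + y * y + z * z)
                                           (+-mono-≤ (rearrangement y≤z z+y≤xy) (rearrangement 2≤x x+2≤y*y)) ⟩
    x * x + y * y + z * z + (u′ + v′) ≈⟨ solve 3 (λ x y z →
        x :* x :+ y :* y :+ z :* z :+ ((y :* (z :+ y) :+ z :* (x :* y)) :+ (con 2 :* (x :+ con 2) :+ x :* (y :* y)))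
        := con 4 :+ x :* y :* z :+ ((y :* (x :* y) :+ z :* (z :+ y)) :+ (con 2 :* (y :* y) :+ x :* (x :+ con 2))))
        refl x y z ⟩
    4# + x * y * z + (u + v)          ∎))
    where
    open ≤-Reasoning
    u u′ v v′ : Carrier
    u  = y * (x * y) + z * (z + y)
    u′ = y * (z + y) + z * (x * y)
    v  = 2# * (y * y) + x * (x + 2#)
    v′ = 2# * (x + 2#) + x * (y * y)
    0≤x : 0# ≤ x
    0≤x = ≤-trans (proj₁ 0<2) 2≤x
    x+2≤y*y : x + 2# ≤ y * y
    x+2≤y*y = begin
      x + 2#  ≤⟨ +-monoʳ-≤ x 2≤x ⟩
      x + x   ≈⟨ solve 1 (λ x → x :+ x := con 2 :* x) refl x ⟩
      2# * x  ≤⟨ *-mono-≤-nonNeg (proj₁ 0<2) 0≤x 2≤x ≤-refl ⟩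
      x * x   ≤⟨ *-mono-≤-nonNeg 0≤x (≤-trans 0≤x x≤y) x≤y x≤y ⟩
      y * y   ∎

  C≤4-if-x≤y≤z : ∀ {x y z} → 0# ≤ x → 0# < y → DoubleBelowProduct x y z →
                   x ≤ y → y ≤ z → C (x , y , z) ≤ 4#
  C≤4-if-x≤y≤z {z = z} 0≤x 0<y (_ , y+y≤zx , z+z≤xy) x≤y y≤z =
    C≤4-if-2≤x≤y≤z (2≤x 0≤x 0<y y+y≤zx z+z≤xy) x≤y y≤z (≤-trans (+-monoʳ-≤ z y≤z) z+z≤xy)

  C≤4-if-least : ∀ {x y z} → Positive (x , y , z) → DoubleBelowProduct x y z →
                 x ≤ y → x ≤ z → C (x , y , z) ≤ 4#
  C≤4-if-least {x} {y} {z} ((0≤x , _) , 0<y , 0<z) d x≤y x≤z with total y z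
  ... | inj₁ y≤z = C≤4-if-x≤y≤z 0≤x 0<y d x≤y y≤z
  ... | inj₂ z≤y = ≤-respˡ-≈ (sym (C-swap x y z))
                     (C≤4-if-x≤y≤z 0≤x 0<z (DoubleBelowProduct-swap d) x≤z z≤y)

  C≤4-if-DoubleBelowProduct : ∀ {x y z} → Positive (x , y , z) → DoubleBelowProduct x y z →
                              C (x , y , z) ≤ 4#
  C≤4-if-DoubleBelowProduct {x} {y} {z} (0<x , 0<y , 0<z) d = by-least (total x y) (total y z) (total z x)
    where
    y-least : y ≤ z → y ≤ x → C (x , y , z) ≤ 4#
    y-least y≤z y≤x = ≤-respˡ-≈ (sym (C-rotate x y z))
      (C≤4-if-least (0<y , 0<z , 0<x) (DoubleBelowProduct-rotate d) y≤z y≤x)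
    z-least : z ≤ x → z ≤ y → C (x , y , z) ≤ 4#
    z-least z≤x z≤y = ≤-respˡ-≈ (sym (trans (C-rotate x y z) (C-rotate y z x)))
      (C≤4-if-least (0<z , 0<x , 0<y) (DoubleBelowProduct-rotate (DoubleBelowProduct-rotate d)) z≤x z≤y)
    by-least : x ≤ y ⊎ y ≤ x → y ≤ z ⊎ z ≤ y → z ≤ x ⊎ x ≤ z → C (x , y , z) ≤ 4#
    by-least (inj₁ x≤y) _          (inj₂ x≤z) = C≤4-if-least (0<x , 0<y , 0<z) d x≤y x≤z
    by-least (inj₁ x≤y) _          (inj₁ z≤x) = z-least z≤x (≤-trans z≤x x≤y)
    by-least (inj₂ y≤x) (inj₁ y≤z) _          = y-least y≤z y≤x
    by-least (inj₂ y≤x) (inj₂ z≤y) _          = z-least (≤-trans z≤y y≤x) z≤y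

lemma8p1 : ∀ {c ℓ₁ ℓ₂} (ℝ : CompleteOrderedField c ℓ₁ ℓ₂) →
    let open CompleteOrderedField ℝ
        open Markov ℝ
    in ∀ (S : ℝ³) → Positive S → M1 S → C S ≤ 4#
lemma8p1 ℝ (_ , _ , _) pos m = C≤4-if-DoubleBelowProduct pos (M1⇒DoubleBelowProduct m)
  where open MarkovProperties ℝ
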